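{- For every positive integer $n$, \[ p(n)=\frac{1}{n!}\sum_{g\in V_n}\prod_{k=1}^n\left((k-1)!^{g(k)}\,(g(k))!\binom{n-\sum_{s=1}^{k-1}s\,g(s)}{g(k)}\prod_{v=1}^{g(k)}\binom{n-\sum_{s=1}^{k-1}s\,g(s)-g(k)-(v-1)(k-1)}{k-1}\right), \] where $V_n=\{g\colon\{1,\dots,n\}\to\{0,\dots,n\} : \sum_{k=1}^n k\,g(k)=n\}$.
   Context: $p(n)$ denotes the number of partitions of the positive integer $n$. Empty products equal $1$, and $\binom{a}{b}$ is the usual binomial coefficient for nonnegative integers $a,b$ (equal to $0$ when $b>a$). -}

module Defs where

open import Data.Nat using (ℕ; zero; suc; _+_; _*_; _∸_; _^_; _≥_; _≤_)
open import Data.Nat using (_!)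
open import Data.Nat.Combinatorics using (_C_)
open import Data.Nat.ListAction using (sum)
open import Data.Fin using (Fin; toℕ; fromℕ<)
open import Data.List using (List; []; _∷_; map; concatMap; upTo; foldr)
open import Data.Product using (Σ; _×_)
open import Relation.Nullary using (¬_)
open import Relation.Binary.PropositionalEquality using (_≡_)
open import Function using (_∘_)

data Decreasing : List ℕ → Set where
  []  : Decreasing []
  [_] : ∀ x → Decreasing (x ∷ [])
  _∷_ : ∀ {x y xs} → x ≥ y → Decreasing (y ∷ xs) → Decreasing (x ∷ y ∷ xs)

data AllPos : List ℕ → Set where
  []  : AllPos []
  _∷_ : ∀ {x xs} → x ≥ 1 → AllPos xs → AllPos (x ∷ xs)

record Partition (n : ℕ) : Set where
  constructor mkPartition
  field
    parts      : List ℕ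
    positive   : AllPos parts
    decreasing : Decreasing parts
    sums       : sum parts ≡ n

range1 : ℕ → List ℕ
range1 n = map suc (upTo n)

sumFrom1 : ℕ → (ℕ → ℕ) → ℕ
sumFrom1 n f = sum (map f (range1 n))

prodFrom1 : ℕ → (ℕ → ℕ) → ℕ
prodFrom1 n f = foldr _*_ 1 (map f (range1 n))

allFin : (m : ℕ) → List (Fin m)
allFin zero = []
allFin (suc m) = Data.Fin.zero ∷ map Data.Fin.suc (allFin m)

allFuns : (n m : ℕ) → List (Fin n → Fin m)
allFuns zero m = (λ ()) ∷ []
allFuns (suc n) m =
  concatMap (λ a → map (λ g → extend a g) (allFuns n m)) (allFin m)
  where
  extend : Fin m → (Fin n → Fin m) → Fin (suc n) → Fin m
  extend a g Data.Fin.zero = a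
  extend a g (Data.Fin.suc i) = g i

-- g : {1..n} → {0..n}, represented as Fin n → Fin (suc n);
-- value at k ∈ {1..n} is toℕ (g (k-1)), and 0 outside {1..n}.

at : ∀ {n} → (Fin n → Fin (suc n)) → ℕ → ℕ
at {n} g zero = 0
at {n} g (suc j) with j Data.Nat.<? n
... | Relation.Nullary.yes j<n = toℕ (g (fromℕ< j<n))
... | Relation.Nullary.no _ = 0

weight : ∀ {n} → (Fin n → Fin (suc n)) → ℕ
weight {n} g = sumFrom1 n (λ k → k * at g k)

inV : ∀ {n} → (Fin n → Fin (suc n)) → ℕ
inV {n} g with weight g Data.Nat.≟ n
... | Relation.Nullary.yes _ = 1
... | Relation.Nullary.no _ = 0

rest : ∀ {n} → (Fin n → Fin (suc n)) → ℕ → ℕ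
rest {n} g k = n ∸ sumFrom1 (k ∸ 1) (λ s → s * at g s)

factor : ∀ {n} → (Fin n → Fin (suc n)) → ℕ → ℕ
factor {n} g k =
  ((k ∸ 1) !) ^ at g k * (at g k) ! * (rest g k C at g k)
  * prodFrom1 (at g k) (λ v → (rest g k ∸ at g k ∸ (v ∸ 1) * (k ∸ 1)) C (k ∸ 1))

summand : ∀ {n} → (Fin n → Fin (suc n)) → ℕ
summand {n} g = prodFrom1 n (factor g)

sumV : ℕ → ℕ
sumV n = sum (map (λ g → inV g * summand g) (allFuns n (suc n)))

-- For g ∈ V_n put r_k = n − Σ_{s<k} s·g(s). The k-th factor counts the ways to choose and order
-- g(k) block heads among r_k elements and then each block's k − 1 further elements, so it equals
-- r_k! / (r_k − k·g(k))! = r_k! / r_{k+1}! and the product telescopes to r_1! / r_{n+1}! = n!.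
-- The right-hand side is therefore n!·|V_n|, and g ↦ (the partition with g(k) parts equal to k)
-- is a bijection from V_n onto the partitions of n.
module Submission where

open import Defs
open import Data.Bool using (Bool; true; false; T)
open import Data.Bool.Properties using (T-irrelevant)
open import Data.Nat using (ℕ; zero; suc; _+_; _*_; _∸_; _^_; _≤_; _<_; z≤n; s≤s; _!)
open import Data.Nat.Properties
open import Data.Nat.Combinatorics using (_C_; nCk≡n!/k![n-k]!; k![n∸k]!∣n!)
open import Data.Nat.DivMod using (_/_; m/n*n≡m)
open import Data.Nat.ListAction using (sum; product)
open import Data.Nat.ListAction.Properties using (sum-++; product-++)
open import Data.Nat.Solver using (module +-*-Solver)
open import Data.Fin using (Fin; toℕ; fromℕ<)
open import Data.Fin.Properties using (+↔⊎; 0↔⊥; 1↔⊤; toℕ-injective; toℕ<n; fromℕ<-toℕ; toℕ-fromℕ<)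
open import Data.Vec using (Vec; []; _∷_; lookup; tabulate)
open import Data.Vec.Properties using (lookup∘tabulate; tabulate∘lookup; tabulate-cong)
open import Data.List using (List; []; _∷_; _++_; map; concatMap; upTo; replicate)
open import Data.List.Properties using (map-++; map-∘; map-cong; upTo-∷ʳ)
open import Data.List.Relation.Unary.All as All using (All; []; _∷_)
open import Data.List.Relation.Unary.All.Properties using (++⁺; replicate⁺)
open import Data.Product using (Σ; _×_; _,_)
open import Data.Product.Function.Dependent.Propositional using (congˡ)
open import Data.Sum using (_⊎_; inj₁; inj₂)
open import Data.Sum.Function.Propositional using (_⊎-↔_)
open import Function using (_∘_)
open import Function.Bundles using (_↔_; mk↔ₛ′)
open import Function.Properties.Inverse using (↔-refl; ↔-sym; ↔-trans)
open import Function.Related.Propositional using (bijection; module EquationalReasoning)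
open import Relation.Nullary using (yes; no; contradiction)
open import Relation.Nullary.Decidable using (⌊_⌋; toWitness; fromWitness)
open import Relation.Binary.Definitions using (tri<; tri≈; tri>; _Respects_)
open import Relation.Binary.PropositionalEquality

open +-*-Solver

map-range1-suc : ∀ (f : ℕ → ℕ) n → map f (range1 (suc n)) ≡ map f (range1 n) ++ f (suc n) ∷ []
map-range1-suc f n = begin
  map f (map suc (upTo (suc n)))              ≡⟨ cong (map f ∘ map suc) (sym (upTo-∷ʳ n)) ⟩
  map f (map suc (upTo n ++ n ∷ []))          ≡⟨ cong (map f) (map-++ suc (upTo n) (n ∷ [])) ⟩
  map f (range1 n ++ suc n ∷ [])              ≡⟨ map-++ f (range1 n) (suc n ∷ []) ⟩
  map f (range1 n) ++ f (suc n) ∷ []          ∎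
  where open ≡-Reasoning

sumFrom1-suc : ∀ n f → sumFrom1 (suc n) f ≡ sumFrom1 n f + f (suc n)
sumFrom1-suc n f = begin
  sum (map f (range1 (suc n)))                ≡⟨ cong sum (map-range1-suc f n) ⟩
  sum (map f (range1 n) ++ f (suc n) ∷ [])    ≡⟨ sum-++ (map f (range1 n)) _ ⟩
  sumFrom1 n f + (f (suc n) + 0)              ≡⟨ cong (sumFrom1 n f +_) (+-identityʳ _) ⟩
  sumFrom1 n f + f (suc n)                    ∎
  where open ≡-Reasoning

prodFrom1-suc : ∀ n f → prodFrom1 (suc n) f ≡ prodFrom1 n f * f (suc n)
prodFrom1-suc n f = begin
  product (map f (range1 (suc n)))              ≡⟨ cong product (map-range1-suc f n) ⟩
  product (map f (range1 n) ++ f (suc n) ∷ [])  ≡⟨ product-++ (map f (range1 n)) _ ⟩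
  prodFrom1 n f * (f (suc n) * 1)               ≡⟨ cong (prodFrom1 n f *_) (*-identityʳ _) ⟩
  prodFrom1 n f * f (suc n)                     ∎
  where open ≡-Reasoning

nCk*k!*[n∸k]!≡n! : ∀ {n k} → k ≤ n → (n C k) * (k ! * (n ∸ k) !) ≡ n !
nCk*k!*[n∸k]!≡n! {n} {k} k≤n = begin
  (n C k) * (k ! * (n ∸ k) !)                   ≡⟨ cong (_* (k ! * (n ∸ k) !)) (nCk≡n!/k![n-k]! k≤n) ⟩
  n ! / (k ! * (n ∸ k) !) * (k ! * (n ∸ k) !) ≡⟨ m/n*n≡m (k![n∸k]!∣n! k≤n) ⟩
  n !                                         ∎
  where
  open ≡-Reasoning
  instance _ = k !* (n ∸ k) !≢0

[j!]^G*∏C*[m∸Gj]!≡m! : ∀ j G m → G * j ≤ m →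
  (j !) ^ G * prodFrom1 G (λ v → (m ∸ (v ∸ 1) * j) C j) * (m ∸ G * j) ! ≡ m !
[j!]^G*∏C*[m∸Gj]!≡m! j zero m _ = +-identityʳ (m !)
[j!]^G*∏C*[m∸Gj]!≡m! j (suc G) m G+1*j≤m = begin
  (j ! * (j !) ^ G) * ∏ (suc G) * (m ∸ (j + G * j)) !
    ≡⟨ cong₂ (λ x y → (j ! * (j !) ^ G) * x * y !) (prodFrom1-suc G _) m∸[j+Gj]≡r∸j ⟩
  (j ! * (j !) ^ G) * (∏ G * (r C j)) * (r ∸ j) !
    ≡⟨ solve 5 (λ a b p c d → (a :* b) :* (p :* c) :* d := b :* p :* (c :* (a :* d)))
         refl (j !) ((j !) ^ G) (∏ G) (r C j) ((r ∸ j) !) ⟩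
  (j !) ^ G * ∏ G * ((r C j) * (j ! * (r ∸ j) !))
    ≡⟨ cong ((j !) ^ G * ∏ G *_) (nCk*k!*[n∸k]!≡n! (m+n≤o⇒m≤o∸n j G+1*j≤m)) ⟩
  (j !) ^ G * ∏ G * r !
    ≡⟨ [j!]^G*∏C*[m∸Gj]!≡m! j G m (m+n≤o⇒n≤o j G+1*j≤m) ⟩
  m ! ∎
  where
  open ≡-Reasoning
  r = m ∸ G * j
  ∏ : ℕ → ℕ
  ∏ G = prodFrom1 G (λ v → (m ∸ (v ∸ 1) * j) C j)
  m∸[j+Gj]≡r∸j : m ∸ (j + G * j) ≡ r ∸ j
  m∸[j+Gj]≡r∸j = trans (cong (m ∸_) (+-comm j (G * j))) (sym (∸-+-assoc m (G * j) j))

factor*[r∸G∸Gj]!≡r! : ∀ j G r → G + G * j ≤ r →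
  (j !) ^ G * G ! * (r C G) * prodFrom1 G (λ v → (r ∸ G ∸ (v ∸ 1) * j) C j) * (r ∸ (G + G * j)) !
  ≡ r !
factor*[r∸G∸Gj]!≡r! j G r G+Gj≤r = begin
  (j !) ^ G * G ! * (r C G) * ∏ * (r ∸ (G + G * j)) !
    ≡⟨ cong (λ x → (j !) ^ G * G ! * (r C G) * ∏ * x !) (sym (∸-+-assoc r G (G * j))) ⟩
  (j !) ^ G * G ! * (r C G) * ∏ * (r ∸ G ∸ G * j) !
    ≡⟨ solve 5 (λ a g c p d → a :* g :* c :* p :* d := c :* (g :* (a :* p :* d)))
         refl ((j !) ^ G) (G !) (r C G) ∏ ((r ∸ G ∸ G * j) !) ⟩
  (r C G) * (G ! * ((j !) ^ G * ∏ * (r ∸ G ∸ G * j) !))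
    ≡⟨ cong (λ x → (r C G) * (G ! * x)) ([j!]^G*∏C*[m∸Gj]!≡m! j G (r ∸ G) Gj≤r∸G) ⟩
  (r C G) * (G ! * (r ∸ G) !)
    ≡⟨ nCk*k!*[n∸k]!≡n! (m+n≤o⇒m≤o G G+Gj≤r) ⟩
  r ! ∎
  where
  open ≡-Reasoning
  ∏ = prodFrom1 G (λ v → (r ∸ G ∸ (v ∸ 1) * j) C j)
  Gj≤r∸G : G * j ≤ r ∸ G
  Gj≤r∸G = m+n≤o⇒m≤o∸n (G * j) (≤-trans (≤-reflexive (+-comm (G * j) G)) G+Gj≤r)

module _ {n : ℕ} (g : Fin n → Fin (suc n)) where

  partialWeight : ℕ → ℕ
  partialWeight k = sumFrom1 k (λ s → s * at g s)

  factors-telescope : ∀ k → partialWeight k ≤ n → prodFrom1 k (factor g) * (n ∸ partialWeight k) ! ≡ n !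
  factors-telescope zero _ = +-identityʳ (n !)
  factors-telescope (suc k) Sk+1≤n = begin
    prodFrom1 (suc k) (factor g) * (n ∸ partialWeight (suc k)) !
      ≡⟨ cong₂ (λ x y → x * (n ∸ y) !) (prodFrom1-suc k (factor g)) partialWeight-suc ⟩
    prodFrom1 k (factor g) * factor g (suc k) * (n ∸ (S + (G + G * k))) !
      ≡⟨ cong (λ x → prodFrom1 k (factor g) * factor g (suc k) * x !) (sym (∸-+-assoc n S (G + G * k))) ⟩
    prodFrom1 k (factor g) * factor g (suc k) * (n ∸ S ∸ (G + G * k)) !
      ≡⟨ *-assoc (prodFrom1 k (factor g)) _ _ ⟩
    prodFrom1 k (factor g) * (factor g (suc k) * (n ∸ S ∸ (G + G * k)) !)
      ≡⟨ cong (prodFrom1 k (factor g) *_) (factor*[r∸G∸Gj]!≡r! k G (n ∸ S) step≤n∸S) ⟩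
    prodFrom1 k (factor g) * (n ∸ S) !
      ≡⟨ factors-telescope k (m+n≤o⇒m≤o S S+step≤n) ⟩
    n ! ∎
    where
    open ≡-Reasoning
    S = partialWeight k
    G = at g (suc k)
    partialWeight-suc : partialWeight (suc k) ≡ S + (G + G * k)
    partialWeight-suc = trans (sumFrom1-suc k (λ s → s * at g s)) (cong (λ x → S + (G + x)) (*-comm k G))
    S+step≤n : S + (G + G * k) ≤ n
    S+step≤n = subst (_≤ n) partialWeight-suc Sk+1≤n
    step≤n∸S : G + G * k ≤ n ∸ S
    step≤n∸S = m+n≤o⇒m≤o∸n (G + G * k) (subst (_≤ n) (+-comm S _) S+step≤n)

  summand≡n! : weight g ≡ n → summand g ≡ n !
  summand≡n! w≡n = begin
    summand g                               ≡⟨ sym (*-identityʳ (summand g)) ⟩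
    summand g * 0 !                         ≡⟨ cong (λ x → summand g * x !) (sym (n∸n≡0 n)) ⟩
    summand g * (n ∸ n) !                   ≡⟨ cong (λ x → summand g * (n ∸ x) !) (sym w≡n) ⟩
    summand g * (n ∸ partialWeight n) !     ≡⟨ factors-telescope n (≤-reflexive w≡n) ⟩
    n !                                     ∎
    where open ≡-Reasoning

indicator : Bool → ℕ
indicator true  = 1
indicator false = 0

countTrue : {A : Set} → (A → Bool) → List A → ℕ
countTrue p xs = sum (map (indicator ∘ p) xs)

countTrue-++ : {A : Set} (p : A → Bool) (xs ys : List A) →
               countTrue p (xs ++ ys) ≡ countTrue p xs + countTrue p ys
countTrue-++ p []       ys = refl
countTrue-++ p (x ∷ xs) ys =
  trans (cong (indicator (p x) +_) (countTrue-++ p xs ys)) (sym (+-assoc (indicator (p x)) _ _))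

countTrue-concatMap : {A B : Set} (p : B → Bool) (F : A → List B) (xs : List A) →
                      countTrue p (concatMap F xs) ≡ sum (map (countTrue p ∘ F) xs)
countTrue-concatMap p F []       = refl
countTrue-concatMap p F (x ∷ xs) =
  trans (countTrue-++ p (F x) (concatMap F xs)) (cong (countTrue p (F x) +_) (countTrue-concatMap p F xs))

countTrue-map : {A B : Set} (p : B → Bool) (f : A → B) (xs : List A) →
                countTrue p (map f xs) ≡ countTrue (p ∘ f) xs
countTrue-map p f []       = refl
countTrue-map p f (x ∷ xs) = cong (indicator (p (f x)) +_) (countTrue-map p f xs)

sum-map-*ˡ : {A : Set} (c : ℕ) (f : A → ℕ) (xs : List A) →
             sum (map (λ x → c * f x) xs) ≡ c * sum (map f xs)
sum-map-*ˡ c f []       = sym (*-zeroʳ c)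
sum-map-*ˡ c f (x ∷ xs) = trans (cong (c * f x +_) (sum-map-*ˡ c f xs)) (sym (*-distribˡ-+ c (f x) _))

Fin-indicator↔T : ∀ b → Fin (indicator b) ↔ T b
Fin-indicator↔T true  = 1↔⊤
Fin-indicator↔T false = 0↔⊥

Σ-Fin-suc↔ : ∀ {m} (P : Fin (suc m) → Set) → (P Fin.zero ⊎ Σ (Fin m) (P ∘ Fin.suc)) ↔ Σ (Fin (suc m)) P
Σ-Fin-suc↔ {m} P = mk↔ₛ′ to from to∘from (λ { (inj₁ _) → refl ; (inj₂ _) → refl })
  where
  to : P Fin.zero ⊎ Σ (Fin m) (P ∘ Fin.suc) → Σ (Fin (suc m)) P
  to (inj₁ x)       = Fin.zero , x
  to (inj₂ (i , x)) = Fin.suc i , x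
  from : Σ (Fin (suc m)) P → P Fin.zero ⊎ Σ (Fin m) (P ∘ Fin.suc)
  from (Fin.zero  , x) = inj₁ x
  from (Fin.suc i , x) = inj₂ (i , x)
  to∘from : ∀ y → to (from y) ≡ y
  to∘from (Fin.zero  , _) = refl
  to∘from (Fin.suc _ , _) = refl

Fin-sum↔Σ : ∀ m (c : Fin m → ℕ) → Fin (sum (map c (allFin m))) ↔ Σ (Fin m) (Fin ∘ c)
Fin-sum↔Σ zero    c = mk↔ₛ′ (λ ()) (λ ()) (λ ()) (λ ())
Fin-sum↔Σ (suc m) c = begin
  Fin (c Fin.zero + sum (map c (map Fin.suc (allFin m))))     ↔⟨ +↔⊎ ⟩
  (Fin (c Fin.zero) ⊎ Fin (sum (map c (map Fin.suc (allFin m))))) ≡⟨ cong (λ s → Fin (c Fin.zero) ⊎ Fin s) (cong sum (sym (map-∘ (allFin m)))) ⟩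
  (Fin (c Fin.zero) ⊎ Fin (sum (map (c ∘ Fin.suc) (allFin m)))) ↔⟨ ↔-refl ⊎-↔ Fin-sum↔Σ m (c ∘ Fin.suc) ⟩
  (Fin (c Fin.zero) ⊎ Σ (Fin m) (Fin ∘ c ∘ Fin.suc))           ↔⟨ Σ-Fin-suc↔ (Fin ∘ c) ⟩
  Σ (Fin (suc m)) (Fin ∘ c)                                    ∎
  where open EquationalReasoning {k = bijection}

-- Functions Fin n → Fin m are handled through their tables, since without function extensionality
-- only predicates respecting _≗_ can be transported between a function and its table.
Satisfying : ∀ {n m} → ((Fin n → Fin m) → Bool) → Set
Satisfying {n} {m} p = Σ (Vec (Fin m) n) (T ∘ p ∘ lookup)

-- The extension operation used by allFuns is local to its definition, so the inductive step is
-- proved for any operation that behaves like cons.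
module _ {n m : ℕ} (p : (Fin (suc n) → Fin m) → Bool) (resp : (T ∘ p) Respects _≗_)
         (extend : Fin m → (Fin n → Fin m) → Fin (suc n) → Fin m)
         (extend-lookup : ∀ a v → extend a (lookup v) ≗ lookup (a ∷ v))
         (extend-cong : ∀ a {g h} → g ≗ h → extend a g ≗ extend a h) where

  Σ-Satisfying-extend↔ : Σ (Fin m) (λ a → Satisfying (p ∘ extend a)) ↔ Satisfying p
  Σ-Satisfying-extend↔ = mk↔ₛ′ to from
    (λ { (a ∷ v , t) → cong (a ∷ v ,_) (T-irrelevant _ t) })
    (λ { (a , v , t) → cong (λ t′ → a , v , t′) (T-irrelevant _ t) })
    where
    to : Σ (Fin m) (λ a → Satisfying (p ∘ extend a)) → Satisfying p
    to (a , v , t) = a ∷ v , resp (extend-lookup a v) t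
    from : Satisfying p → Σ (Fin m) (λ a → Satisfying (p ∘ extend a))
    from (a ∷ v , t) = a , v , resp (sym ∘ extend-lookup a v) t

  Fin-countTrue-extend↔ :
    (∀ q → (T ∘ q) Respects _≗_ → Fin (countTrue q (allFuns n m)) ↔ Satisfying q) →
    Fin (countTrue p (concatMap (λ a → map (extend a) (allFuns n m)) (allFin m))) ↔ Satisfying p
  Fin-countTrue-extend↔ Fin-countTrue↔ = begin
    Fin (countTrue p (concatMap (λ a → map (extend a) (allFuns n m)) (allFin m)))
      ≡⟨ cong Fin (countTrue-concatMap p _ (allFin m)) ⟩
    Fin (sum (map (λ a → countTrue p (map (extend a) (allFuns n m))) (allFin m)))
      ≡⟨ cong (Fin ∘ sum) (map-cong (λ a → countTrue-map p (extend a) (allFuns n m)) (allFin m)) ⟩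
    Fin (sum (map (λ a → countTrue (p ∘ extend a) (allFuns n m)) (allFin m)))
      ↔⟨ Fin-sum↔Σ m _ ⟩
    Σ (Fin m) (λ a → Fin (countTrue (p ∘ extend a) (allFuns n m)))
      ↔⟨ congˡ (λ {a} → Fin-countTrue↔ (p ∘ extend a) (resp ∘ extend-cong a)) ⟩
    Σ (Fin m) (λ a → Satisfying (p ∘ extend a))
      ↔⟨ Σ-Satisfying-extend↔ ⟩
    Satisfying p ∎
    where open EquationalReasoning {k = bijection}

Fin-countTrue-allFuns↔ : ∀ n m (p : (Fin n → Fin m) → Bool) → (T ∘ p) Respects _≗_ →
                         Fin (countTrue p (allFuns n m)) ↔ Satisfying p
Fin-countTrue-allFuns↔ zero m p resp = begin
  Fin (indicator (p (λ ())) + 0) ≡⟨ cong Fin (+-identityʳ _) ⟩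
  Fin (indicator (p (λ ())))     ↔⟨ Fin-indicator↔T _ ⟩
  T (p (λ ()))                   ↔⟨ T↔Satisfying ⟩
  Satisfying p                   ∎
  where
  open EquationalReasoning {k = bijection}
  T↔Satisfying : T (p (λ ())) ↔ Satisfying p
  T↔Satisfying = mk↔ₛ′ (λ t → [] , resp (λ ()) t) (λ { ([] , t) → resp (λ ()) t })
    (λ { ([] , t) → cong ([] ,_) (T-irrelevant _ t) }) (λ t → T-irrelevant _ t)
Fin-countTrue-allFuns↔ (suc n) m p resp =
  Fin-countTrue-extend↔ p resp _
    (λ _ _ → λ { Fin.zero → refl ; (Fin.suc _) → refl })
    (λ _ g≗h → λ { Fin.zero → refl ; (Fin.suc i) → g≗h i })
    (Fin-countTrue-allFuns↔ n m)

multiplicity : ℕ → List ℕ → ℕ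
multiplicity k = countTrue (λ x → ⌊ k ≟ x ⌋)

multiplicity-++ : ∀ k xs ys → multiplicity k (xs ++ ys) ≡ multiplicity k xs + multiplicity k ys
multiplicity-++ k = countTrue-++ (λ x → ⌊ k ≟ x ⌋)

multiplicity-self-∷ : ∀ x xs → multiplicity x (x ∷ xs) ≡ suc (multiplicity x xs)
multiplicity-self-∷ x xs with x ≟ x
... | yes _   = refl
... | no x≢x = contradiction refl x≢x

multiplicity-self-∷≢0 : ∀ x xs → multiplicity x (x ∷ xs) ≢ 0
multiplicity-self-∷≢0 x xs eq with () ← trans (sym (multiplicity-self-∷ x xs)) eq

multiplicity-none : ∀ {k} l → All (k ≢_) l → multiplicity k l ≡ 0
multiplicity-none []       []           = refl
multiplicity-none {k} (x ∷ xs) (k≢x ∷ ks) with k ≟ x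
... | yes k≡x = contradiction k≡x k≢x
... | no _    = multiplicity-none xs ks

multiplicity-above : ∀ {k} l → All (_< k) l → multiplicity k l ≡ 0
multiplicity-above l = multiplicity-none l ∘ All.map (λ x<k k≡x → <-irrefl (sym k≡x) x<k)

multiplicity-replicate : ∀ a j → multiplicity j (replicate a j) ≡ a
multiplicity-replicate zero    j = refl
multiplicity-replicate (suc a) j =
  trans (multiplicity-self-∷ j (replicate a j)) (cong suc (multiplicity-replicate a j))

multiplicity-zero : ∀ {l} → AllPos l → multiplicity 0 l ≡ 0
multiplicity-zero []              = refl
multiplicity-zero (s≤s z≤n ∷ ps) = multiplicity-zero ps

multiplicity≤sum : ∀ k {l} → AllPos l → multiplicity k l ≤ sum l
multiplicity≤sum k []                 = z≤n
multiplicity≤sum k {x ∷ xs} (1≤x ∷ ps) with k ≟ x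
... | yes _ = +-mono-≤ 1≤x (multiplicity≤sum k ps)
... | no _  = ≤-trans (multiplicity≤sum k ps) (m≤n+m (sum xs) x)

All≤sum : ∀ l → All (_≤ sum l) l
All≤sum []       = []
All≤sum (x ∷ xs) = m≤m+n x (sum xs) ∷ All.map (λ x≤s → ≤-trans x≤s (m≤n+m (sum xs) x)) (All≤sum xs)

Decreasing-∷ : ∀ {x l} → Decreasing l → All (_≤ x) l → Decreasing (x ∷ l)
Decreasing-∷ {x} []         []          = [ x ]
Decreasing-∷ {x} [ y ]      (y≤x ∷ _)   = y≤x ∷ [ y ]
Decreasing-∷     (y≤z ∷ d)  (z≤x ∷ _)   = z≤x ∷ y≤z ∷ d

Decreasing-replicate-++ : ∀ a {j l} → Decreasing l → All (_≤ j) l → Decreasing (replicate a j ++ l)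
Decreasing-replicate-++ zero    d l≤j = d
Decreasing-replicate-++ (suc a) d l≤j =
  Decreasing-∷ (Decreasing-replicate-++ a d l≤j) (++⁺ (replicate⁺ a ≤-refl) l≤j)

Decreasing⇒All≤head : ∀ {x xs} → Decreasing (x ∷ xs) → All (_≤ x) (x ∷ xs)
Decreasing⇒All≤head [ x ]       = ≤-refl ∷ []
Decreasing⇒All≤head (y≤x ∷ d) with Decreasing⇒All≤head d
... | _ ∷ xs≤y = ≤-refl ∷ y≤x ∷ All.map (λ z≤y → ≤-trans z≤y y≤x) xs≤y

Decreasing-tail : ∀ {x xs} → Decreasing (x ∷ xs) → Decreasing xs
Decreasing-tail [ _ ]   = []
Decreasing-tail (_ ∷ d) = d

Decreasing-irrelevant : ∀ {l} (d e : Decreasing l) → d ≡ e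
Decreasing-irrelevant []        []        = refl
Decreasing-irrelevant [ _ ]     [ _ ]     = refl
Decreasing-irrelevant (p ∷ d) (q ∷ e) = cong₂ _∷_ (≤-irrelevant p q) (Decreasing-irrelevant d e)

AllPos-irrelevant : ∀ {l} (a b : AllPos l) → a ≡ b
AllPos-irrelevant []      []      = refl
AllPos-irrelevant (p ∷ a) (q ∷ b) = cong₂ _∷_ (≤-irrelevant p q) (AllPos-irrelevant a b)

Partition-≡ : ∀ {n} {P Q : Partition n} → Partition.parts P ≡ Partition.parts Q → P ≡ Q
Partition-≡ {P = mkPartition l a d s} {mkPartition .l a′ d′ s′} refl
  rewrite AllPos-irrelevant a a′ | Decreasing-irrelevant d d′ | ≡-irrelevant s s′ = refl

Decreasing-multiplicity-above : ∀ {x xs k} → Decreasing (x ∷ xs) → x < k → multiplicity k (x ∷ xs) ≡ 0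
Decreasing-multiplicity-above {x} {xs} d x<k =
  multiplicity-above (x ∷ xs) (All.map (λ y≤x → ≤-<-trans y≤x x<k) (Decreasing⇒All≤head d))

Decreasing-multiplicity-injective : ∀ {xs ys} → Decreasing xs → Decreasing ys →
  (∀ k → multiplicity k xs ≡ multiplicity k ys) → xs ≡ ys
Decreasing-multiplicity-injective {[]}     {[]}     _  _  _  = refl
Decreasing-multiplicity-injective {[]}     {y ∷ ys} _  _  eq = contradiction (sym (eq y)) (multiplicity-self-∷≢0 y ys)
Decreasing-multiplicity-injective {x ∷ xs} {[]}     _  _  eq = contradiction (eq x) (multiplicity-self-∷≢0 x xs)
Decreasing-multiplicity-injective {x ∷ xs} {y ∷ ys} dx dy eq with <-cmp x y
... | tri< x<y _ _ = contradiction (trans (sym (eq y)) (Decreasing-multiplicity-above dx x<y)) (multiplicity-self-∷≢0 y ys)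
... | tri> _ _ y<x = contradiction (trans (eq x) (Decreasing-multiplicity-above dy y<x)) (multiplicity-self-∷≢0 x xs)
... | tri≈ _ refl _ = cong (x ∷_) (Decreasing-multiplicity-injective (Decreasing-tail dx) (Decreasing-tail dy)
        (λ k → +-cancelˡ-≡ (indicator ⌊ k ≟ x ⌋) _ _ (eq k)))

fromMultiplicities : ℕ → (ℕ → ℕ) → List ℕ
fromMultiplicities zero    c = []
fromMultiplicities (suc K) c = replicate (c (suc K)) (suc K) ++ fromMultiplicities K c

module _ (c : ℕ → ℕ) where

  fromMultiplicities-≤ : ∀ K → All (_≤ K) (fromMultiplicities K c)
  fromMultiplicities-≤ zero    = []
  fromMultiplicities-≤ (suc K) =
    ++⁺ (replicate⁺ (c (suc K)) ≤-refl) (All.map m≤n⇒m≤1+n (fromMultiplicities-≤ K))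

  fromMultiplicities-positive : ∀ K → AllPos (fromMultiplicities K c)
  fromMultiplicities-positive zero    = []
  fromMultiplicities-positive (suc K) = replicate-++ (c (suc K))
    where
    replicate-++ : ∀ a → AllPos (replicate a (suc K) ++ fromMultiplicities K c)
    replicate-++ zero    = fromMultiplicities-positive K
    replicate-++ (suc a) = s≤s z≤n ∷ replicate-++ a

  fromMultiplicities-decreasing : ∀ K → Decreasing (fromMultiplicities K c)
  fromMultiplicities-decreasing zero    = []
  fromMultiplicities-decreasing (suc K) = Decreasing-replicate-++ (c (suc K))
    (fromMultiplicities-decreasing K) (All.map m≤n⇒m≤1+n (fromMultiplicities-≤ K))

  sum-fromMultiplicities : ∀ K → sum (fromMultiplicities K c) ≡ sumFrom1 K (λ k → k * c k)
  sum-fromMultiplicities zero    = refl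
  sum-fromMultiplicities (suc K) = begin
    sum (replicate (c (suc K)) (suc K) ++ fromMultiplicities K c)
      ≡⟨ sum-++ (replicate (c (suc K)) (suc K)) _ ⟩
    sum (replicate (c (suc K)) (suc K)) + sum (fromMultiplicities K c)
      ≡⟨ cong₂ _+_ (sum-replicate (c (suc K))) (sum-fromMultiplicities K) ⟩
    suc K * c (suc K) + sumFrom1 K (λ k → k * c k)
      ≡⟨ +-comm (suc K * c (suc K)) _ ⟩
    sumFrom1 K (λ k → k * c k) + suc K * c (suc K)
      ≡⟨ sym (sumFrom1-suc K (λ k → k * c k)) ⟩
    sumFrom1 (suc K) (λ k → k * c k) ∎
    where
    open ≡-Reasoning
    sum-replicate : ∀ a → sum (replicate a (suc K)) ≡ suc K * a
    sum-replicate zero    = sym (*-zeroʳ K)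
    sum-replicate (suc a) = trans (cong (suc K +_) (sum-replicate a)) (sym (*-suc (suc K) a))

  multiplicity-fromMultiplicities : ∀ {k} K → 1 ≤ k → k ≤ K → multiplicity k (fromMultiplicities K c) ≡ c k
  multiplicity-fromMultiplicities zero    (s≤s z≤n) ()
  multiplicity-fromMultiplicities {k} (suc K) 1≤k k≤K+1 with m≤n⇒m<n∨m≡n k≤K+1
  ... | inj₁ (s≤s k≤K) = begin
    multiplicity k (replicate (c (suc K)) (suc K) ++ fromMultiplicities K c)
      ≡⟨ multiplicity-++ k (replicate (c (suc K)) (suc K)) _ ⟩
    multiplicity k (replicate (c (suc K)) (suc K)) + multiplicity k (fromMultiplicities K c)
      ≡⟨ cong₂ _+_ (multiplicity-none _ (replicate⁺ (c (suc K)) (λ k≡K+1 → <-irrefl k≡K+1 (s≤s k≤K))))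
                   (multiplicity-fromMultiplicities K 1≤k k≤K) ⟩
    c k ∎
    where open ≡-Reasoning
  ... | inj₂ refl = begin
    multiplicity k (replicate (c k) k ++ fromMultiplicities K c)
      ≡⟨ multiplicity-++ k (replicate (c k) k) _ ⟩
    multiplicity k (replicate (c k) k) + multiplicity k (fromMultiplicities K c)
      ≡⟨ cong₂ _+_ (multiplicity-replicate (c k) k)
                   (multiplicity-above _ (All.map s≤s (fromMultiplicities-≤ K))) ⟩
    c k + 0
      ≡⟨ +-identityʳ (c k) ⟩
    c k ∎
    where open ≡-Reasoning

module _ {n : ℕ} where

  at-cong : ∀ {g h : Fin n → Fin (suc n)} → g ≗ h → ∀ k → at g k ≡ at h k
  at-cong g≗h zero    = refl
  at-cong g≗h (suc j) with j <? n
  ... | yes _ = cong toℕ (g≗h _)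
  ... | no _  = refl

  at-suc : ∀ (g : Fin n → Fin (suc n)) {j} (j<n : j < n) → at g (suc j) ≡ toℕ (g (fromℕ< j<n))
  at-suc g {j} j<n with j <? n
  ... | yes j<n′ = cong (λ p → toℕ (g (fromℕ< p))) (<-irrelevant j<n′ j<n)
  ... | no j≮n = contradiction j<n j≮n

  at-suc-≥ : ∀ (g : Fin n → Fin (suc n)) {j} → n ≤ j → at g (suc j) ≡ 0
  at-suc-≥ g {j} n≤j with j <? n
  ... | yes j<n = contradiction j<n (≤⇒≯ n≤j)
  ... | no _    = refl

  at-suc-toℕ : ∀ (g : Fin n → Fin (suc n)) i → at g (suc (toℕ i)) ≡ toℕ (g i)
  at-suc-toℕ g i = trans (at-suc g (toℕ<n i)) (cong (toℕ ∘ g) (fromℕ<-toℕ i (toℕ<n i)))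

  multiplicity-fromMultiplicities-at : ∀ (g : Fin n → Fin (suc n)) k →
    multiplicity k (fromMultiplicities n (at g)) ≡ at g k
  multiplicity-fromMultiplicities-at g zero = multiplicity-zero (fromMultiplicities-positive (at g) n)
  multiplicity-fromMultiplicities-at g (suc j) with <-≤-connex j n
  ... | inj₁ j<n = multiplicity-fromMultiplicities (at g) n (s≤s z≤n) j<n
  ... | inj₂ n≤j = trans
    (multiplicity-above _ (All.map (λ x≤n → s≤s (≤-trans x≤n n≤j)) (fromMultiplicities-≤ (at g) n)))
    (sym (at-suc-≥ g n≤j))

hasWeight : ∀ n → (Fin n → Fin (suc n)) → Bool
hasWeight n g = ⌊ weight g ≟ n ⌋

hasWeight-respects : ∀ n → (T ∘ hasWeight n) Respects _≗_
hasWeight-respects n {g} {h} g≗h = subst (λ w → T ⌊ w ≟ n ⌋) weight-g≡weight-h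
  where
  weight-g≡weight-h : weight g ≡ weight h
  weight-g≡weight-h = cong sum (map-cong (λ k → cong (k *_) (at-cong g≗h k)) (range1 n))

module _ (N : ℕ) where

  multiplicity<suc : (P : Partition N) → ∀ k → multiplicity k (Partition.parts P) < suc N
  multiplicity<suc (mkPartition l pos _ l-sums) k = s≤s (subst (_ ≤_) l-sums (multiplicity≤sum k pos))

  multiplicityVector : Partition N → Vec (Fin (suc N)) N
  multiplicityVector P = tabulate (λ i → fromℕ< (multiplicity<suc P (suc (toℕ i))))

  at-multiplicityVector : ∀ P k → at (lookup (multiplicityVector P)) k ≡ multiplicity k (Partition.parts P)
  at-multiplicityVector P zero = sym (multiplicity-zero (Partition.positive P))
  at-multiplicityVector P (suc j) with <-≤-connex j N
  ... | inj₁ j<N = begin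
    at (lookup (multiplicityVector P)) (suc j)
      ≡⟨ at-suc _ j<N ⟩
    toℕ (lookup (multiplicityVector P) (fromℕ< j<N))
      ≡⟨ cong toℕ (lookup∘tabulate _ (fromℕ< j<N)) ⟩
    toℕ (fromℕ< (multiplicity<suc P (suc (toℕ (fromℕ< j<N)))))
      ≡⟨ toℕ-fromℕ< _ ⟩
    multiplicity (suc (toℕ (fromℕ< j<N))) (Partition.parts P)
      ≡⟨ cong (λ i → multiplicity (suc i) (Partition.parts P)) (toℕ-fromℕ< j<N) ⟩
    multiplicity (suc j) (Partition.parts P) ∎
    where open ≡-Reasoning
  ... | inj₂ N≤j = trans (at-suc-≥ _ N≤j) (sym (multiplicity-above _ (All.map below (All≤sum (Partition.parts P)))))
    where
    below : ∀ {x} → x ≤ sum (Partition.parts P) → x < suc j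
    below x≤sum = s≤s (≤-trans x≤sum (subst (_≤ j) (sym (Partition.sums P)) N≤j))

  fromMultiplicities-multiplicityVector : ∀ P →
    fromMultiplicities N (at (lookup (multiplicityVector P))) ≡ Partition.parts P
  fromMultiplicities-multiplicityVector P =
    Decreasing-multiplicity-injective (fromMultiplicities-decreasing _ N) (Partition.decreasing P)
      (λ k → trans (multiplicity-fromMultiplicities-at _ k) (at-multiplicityVector P k))

  Partition↔Satisfying : Partition N ↔ Satisfying (hasWeight N)
  Partition↔Satisfying = mk↔ₛ′ to from to∘from (λ P → Partition-≡ (fromMultiplicities-multiplicityVector P))
    where
    to : Partition N → Satisfying (hasWeight N)
    to P = multiplicityVector P , fromWitness (begin
      weight (lookup (multiplicityVector P))
        ≡⟨ sym (sum-fromMultiplicities _ N) ⟩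
      sum (fromMultiplicities N (at (lookup (multiplicityVector P))))
        ≡⟨ cong sum (fromMultiplicities-multiplicityVector P) ⟩
      sum (Partition.parts P)
        ≡⟨ Partition.sums P ⟩
      N ∎)
      where open ≡-Reasoning
    from : Satisfying (hasWeight N) → Partition N
    from (v , t) = mkPartition (fromMultiplicities N (at (lookup v)))
      (fromMultiplicities-positive _ N) (fromMultiplicities-decreasing _ N)
      (trans (sum-fromMultiplicities _ N) (toWitness t))
    to∘from : ∀ y → to (from y) ≡ y
    to∘from (v , t) = Σ-≡ (trans (tabulate-cong entry) (tabulate∘lookup v))
      where
      entry : ∀ i → fromℕ< (multiplicity<suc (from (v , t)) (suc (toℕ i))) ≡ lookup v i
      entry i = toℕ-injective (begin
        toℕ (fromℕ< (multiplicity<suc (from (v , t)) (suc (toℕ i))))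
          ≡⟨ toℕ-fromℕ< _ ⟩
        multiplicity (suc (toℕ i)) (fromMultiplicities N (at (lookup v)))
          ≡⟨ multiplicity-fromMultiplicities-at (lookup v) (suc (toℕ i)) ⟩
        at (lookup v) (suc (toℕ i))
          ≡⟨ at-suc-toℕ (lookup v) i ⟩
        toℕ (lookup v i) ∎)
        where open ≡-Reasoning
      Σ-≡ : ∀ {w} {s : T (hasWeight N (lookup w))} → w ≡ v → (w , s) ≡ (v , t)
      Σ-≡ refl = cong (v ,_) (T-irrelevant _ t)

inV*summand≡n!*hasWeight : ∀ {n} (g : Fin n → Fin (suc n)) → inV g * summand g ≡ n ! * indicator (hasWeight n g)
inV*summand≡n!*hasWeight {n} g with weight g ≟ n
... | yes w≡n = trans (+-identityʳ _) (trans (summand≡n! g w≡n) (sym (*-identityʳ (n !))))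
... | no _    = sym (*-zeroʳ (n !))

sumV≡n!*countTrue : ∀ n → sumV n ≡ n ! * countTrue (hasWeight n) (allFuns n (suc n))
sumV≡n!*countTrue n = trans (cong sum (map-cong inV*summand≡n!*hasWeight (allFuns n (suc n))))
                            (sum-map-*ˡ (n !) (indicator ∘ hasWeight n) (allFuns n (suc n)))

mainTheorem1 : (n : ℕ) → Σ ℕ (λ m → (Partition (suc n) ↔ Fin m) × ((suc n) ! * m ≡ sumV (suc n)))
mainTheorem1 n = countTrue (hasWeight N) (allFuns N (suc N))
               , ↔-trans (Partition↔Satisfying N) (↔-sym (Fin-countTrue-allFuns↔ N (suc N) (hasWeight N) (hasWeight-respects N)))
               , sym (sumV≡n!*countTrue N)
  where N = suc n
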